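{- Let $\Gamma$ be a finite bipartite graph with sides $A$ and $B$ such that every vertex of $B$ has degree at least $1$. Call a subset $H \subset A \cup B$ admissible if each vertex of $B \cap H$ has exactly one neighbor in $A \cap H$. Then there exists an admissible $H$ with $|B \cap H| \geq \sqrt{|B|}$. -}

module Defs where

open import Data.Nat using (ℕ; _*_; _≤_)
open import Data.Bool using (Bool; true)
open import Data.Fin using (Fin)
open import Data.Fin.Subset using (Subset; _∈_; ∣_∣)
open import Data.Product using (Σ; _×_; ∃)
open import Relation.Binary.PropositionalEquality using (_≡_)

-- A finite bipartite graph with sides A = Fin a and B = Fin b,
-- given by its biadjacency relation: adj i j ≡ true iff i ∈ A and j ∈ B are adjacent.
BipartiteGraph : ℕ → ℕ → Set
BipartiteGraph a b = Fin a → Fin b → Bool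

BSideNoIsolated : ∀ {a b} → BipartiteGraph a b → Set
BSideNoIsolated {a} {b} Γ = (j : Fin b) → ∃ λ (i : Fin a) → Γ i j ≡ true

-- A subset H ⊆ A ∪ B is given by its two parts HA = A ∩ H and HB = B ∩ H.
-- H is admissible if each vertex of HB has exactly one neighbour in HA.
Admissible : ∀ {a b} → BipartiteGraph a b → Subset a → Subset b → Set
Admissible {a} {b} Γ HA HB =
  (j : Fin b) → j ∈ HB →
  Σ (Fin a) λ i → (i ∈ HA × Γ i j ≡ true) ×
    ((i' : Fin a) → i' ∈ HA → Γ i' j ≡ true → i' ≡ i)

module Submission where

-- Let D be the largest degree of a vertex of A.  Two admissible sets compete:
--
--   * the star of a vertex of maximal degree, {i₀} ∪ N(i₀), whose B-part has D vertices;
--   * a greedy sweep through A, whose B-part H satisfies |B| ≤ |H| · D.  The sweep keeps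
--     a set T ⊆ B of vertices still to be dominated.  A vertex i of A is taken when some
--     t ∈ T is adjacent to i but to no later vertex of A: then t joins H (i is its only
--     neighbour among the taken vertices) and N(i) is removed from T, so each vertex of H
--     pays for at most D vertices of T.  Otherwise i is skipped, and every vertex of T
--     still has a neighbour among the later vertices.
--
-- Since |B| ≤ h · D implies |B| ≤ h² or |B| ≤ D², one of the two sets has |B ∩ H|² ≥ |B|.

open import Defs
open import Data.Nat using (ℕ; zero; suc; _+_; _*_; _≤_; _≤?_; z≤n; s≤s)
open import Data.Nat.Properties
  using (≤-refl; ≤-trans; ≤-reflexive; ≤-total; n≤1+n; +-suc; +-comm; +-mono-≤;
         *-monoˡ-≤; *-monoʳ-≤; ≰⇒>; <⇒≤)
open import Data.Bool using (true)
open import Data.Bool.Properties using (_≟_)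
open import Data.Fin using (Fin; zero; suc)
open import Data.Fin.Properties using (any?)
open import Data.Fin.Subset using (Subset; inside; outside; ∣_∣; _∈_; _∉_; _⊆_; _─_; _∪_; ⁅_⁆; ⊤; ⊥)
open import Data.Fin.Subset.Properties
  using (_∈?_; ∉⊥; ∣⊤∣≡n; ∣⊥∣≡0; x∈⁅x⁆; x∈⁅y⁆⇒x≡y; x∈p∪q⁻; p─q⊆p; p⊆q⇒∣p∣≤∣q∣; ∪-identityˡ)
open import Data.Product using (Σ; ∃; _×_; _,_; proj₁)
open import Data.Sum using (_⊎_; inj₁; inj₂)
open import Data.Empty using (⊥-elim)
open import Data.Vec using ([]; _∷_; tabulate; here; there)
open import Data.Vec.Properties using (lookup∘tabulate; lookup⇒[]=; []=⇒lookup)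
open import Function using (_∘_)
open import Relation.Binary.PropositionalEquality using (_≡_; refl; sym; trans; cong; subst)
open import Relation.Nullary using (¬_; Dec; yes; no; ¬?)
open import Relation.Nullary.Decidable using (_×-dec_)

∣p∣≤∣p─q∣+∣q∣ : ∀ {n} (p q : Subset n) → ∣ p ∣ ≤ ∣ p ─ q ∣ + ∣ q ∣
∣p∣≤∣p─q∣+∣q∣ []            []            = z≤n
∣p∣≤∣p─q∣+∣q∣ (inside  ∷ p) (inside  ∷ q) =
  subst (suc ∣ p ∣ ≤_) (sym (+-suc ∣ p ─ q ∣ ∣ q ∣)) (s≤s (∣p∣≤∣p─q∣+∣q∣ p q))
∣p∣≤∣p─q∣+∣q∣ (inside  ∷ p) (outside ∷ q) = s≤s (∣p∣≤∣p─q∣+∣q∣ p q)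
∣p∣≤∣p─q∣+∣q∣ (outside ∷ p) (inside  ∷ q) =
  ≤-trans (∣p∣≤∣p─q∣+∣q∣ p q)
          (subst (∣ p ─ q ∣ + ∣ q ∣ ≤_) (sym (+-suc ∣ p ─ q ∣ ∣ q ∣)) (n≤1+n _))
∣p∣≤∣p─q∣+∣q∣ (outside ∷ p) (outside ∷ q) = ∣p∣≤∣p─q∣+∣q∣ p q

∣⁅x⁆∪p∣≡1+∣p∣ : ∀ {n} (x : Fin n) (p : Subset n) → x ∉ p → ∣ ⁅ x ⁆ ∪ p ∣ ≡ suc ∣ p ∣
∣⁅x⁆∪p∣≡1+∣p∣ zero    (inside  ∷ p) x∉p = ⊥-elim (x∉p here)
∣⁅x⁆∪p∣≡1+∣p∣ zero    (outside ∷ p) x∉p = cong (suc ∘ ∣_∣) (∪-identityˡ p)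
∣⁅x⁆∪p∣≡1+∣p∣ (suc x) (inside  ∷ p) x∉p = cong suc (∣⁅x⁆∪p∣≡1+∣p∣ x p (x∉p ∘ there))
∣⁅x⁆∪p∣≡1+∣p∣ (suc x) (outside ∷ p) x∉p = ∣⁅x⁆∪p∣≡1+∣p∣ x p (x∉p ∘ there)

x∈p─q⇒x∉q : ∀ {n} {x : Fin n} (p q : Subset n) → x ∈ p ─ q → x ∉ q
x∈p─q⇒x∉q (_ ∷ p) (inside  ∷ q) ()        here
x∈p─q⇒x∉q (_ ∷ p) (outside ∷ q) here      ()
x∈p─q⇒x∉q (_ ∷ p) (_       ∷ q) (there m) (there m') = x∈p─q⇒x∉q p q m m'

⁅x⁆∪p⊆q : ∀ {n} {x : Fin n} {p q : Subset n} → x ∈ q → p ⊆ q → ⁅ x ⁆ ∪ p ⊆ q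
⁅x⁆∪p⊆q {x = x} {p} x∈q p⊆q {y} y∈⁅x⁆∪p with x∈p∪q⁻ ⁅ x ⁆ p y∈⁅x⁆∪p
... | inj₁ y∈⁅x⁆ = subst (_∈ _) (sym (x∈⁅y⁆⇒x≡y x y∈⁅x⁆)) x∈q
... | inj₂ y∈p   = p⊆q y∈p

module _ {a b : ℕ} (Γ : BipartiteGraph a b) where

  neighbours : Fin a → Subset b
  neighbours i = tabulate (Γ i)

  degree : Fin a → ℕ
  degree i = ∣ neighbours i ∣

  ∈-neighbours⁺ : ∀ {i j} → Γ i j ≡ true → j ∈ neighbours i
  ∈-neighbours⁺ {i} {j} e = lookup⇒[]= j (neighbours i) (trans (lookup∘tabulate (Γ i) j) e)

  ∈-neighbours⁻ : ∀ {i j} → j ∈ neighbours i → Γ i j ≡ true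
  ∈-neighbours⁻ {i} {j} m = trans (sym (lookup∘tabulate (Γ i) j)) ([]=⇒lookup m)

  Dominated : Subset b → Set
  Dominated T = ∀ j → j ∈ T → ∃ λ i → Γ i j ≡ true

  record AdmissibleSet : Set where
    constructor admissibleSet
    field
      HA : Subset a
      HB : Subset b
      isAdmissible : Admissible Γ HA HB

  star : Fin a → AdmissibleSet
  star i = admissibleSet ⁅ i ⁆ (neighbours i)
    λ j j∈N → i , (x∈⁅x⁆ i , ∈-neighbours⁻ j∈N) , λ i' i'∈⁅i⁆ _ → x∈⁅y⁆⇒x≡y i i'∈⁅i⁆

open AdmissibleSet

module _ {a b : ℕ} (Γ : BipartiteGraph (suc a) b) where

  later : BipartiteGraph a b
  later i = Γ (suc i)

  PrivateToFirst : Fin b → Set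
  PrivateToFirst t = Γ zero t ≡ true × ¬ (∃ λ i → later i t ≡ true)

  privateToFirst? : ∀ t → Dec (PrivateToFirst t)
  privateToFirst? t = (Γ zero t ≟ true) ×-dec ¬? (any? λ i → later i t ≟ true)

  admissible-skip : ∀ {HA HB} → Admissible later HA HB → Admissible Γ (outside ∷ HA) HB
  admissible-skip {HA} adm j j∈HB with adm j j∈HB
  ... | i , (i∈HA , e) , unique = suc i , (there i∈HA , e) , unique′
    where
    unique′ : ∀ i' → i' ∈ outside ∷ HA → Γ i' j ≡ true → i' ≡ suc i
    unique′ (suc k) (there k∈HA) e' = cong suc (unique k k∈HA e')

  -- Taking the first vertex together with a private neighbour t keeps admissibility,
  -- provided HB avoids N(0): then the first vertex is nobody else's neighbour in HA.
  admissible-take : ∀ {HA HB t} → Admissible later HA HB →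
    (∀ {j} → j ∈ HB → j ∉ neighbours Γ zero) → PrivateToFirst t →
    Admissible Γ (inside ∷ HA) (⁅ t ⁆ ∪ HB)
  admissible-take {HA} {HB} {t} adm HB∩N₀≡∅ (t~0 , ¬t~later) j j∈H
    with x∈p∪q⁻ ⁅ t ⁆ HB j∈H
  ... | inj₁ j∈⁅t⁆ rewrite x∈⁅y⁆⇒x≡y t j∈⁅t⁆ = zero , (here , t~0) , unique
    where
    unique : ∀ i' → i' ∈ inside ∷ HA → Γ i' t ≡ true → i' ≡ zero
    unique zero    _ _ = refl
    unique (suc k) _ e = ⊥-elim (¬t~later (k , e))
  ... | inj₂ j∈HB with adm j j∈HB
  ...   | i , (i∈HA , e) , unique = suc i , (there i∈HA , e) , unique′
    where
    unique′ : ∀ i' → i' ∈ inside ∷ HA → Γ i' j ≡ true → i' ≡ suc i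
    unique′ zero    _            e' = ⊥-elim (HB∩N₀≡∅ j∈HB (∈-neighbours⁺ Γ e'))
    unique′ (suc k) (there k∈HA) e' = cong suc (unique k k∈HA e')

  dominated-skip : ∀ {T} → Dominated Γ T → ¬ (∃ λ t → t ∈ T × PrivateToFirst t) →
    Dominated later T
  dominated-skip dom noPrivate j j∈T with dom j j∈T
  ... | suc i , e = i , e
  ... | zero  , e with any? (λ i → later i j ≟ true)
  ...   | yes laterNeighbour = laterNeighbour
  ...   | no  noLater        = ⊥-elim (noPrivate (j , j∈T , e , noLater))

  dominated-take : ∀ {T} → Dominated Γ T → Dominated later (T ─ neighbours Γ zero)
  dominated-take {T} dom j j∈T─N₀ with dom j (p─q⊆p T _ j∈T─N₀)
  ... | suc i , e = i , e
  ... | zero  , e = ⊥-elim (x∈p─q⇒x∉q T _ j∈T─N₀ (∈-neighbours⁺ Γ e))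

greedy : ∀ {a b} (Γ : BipartiteGraph a b) (D : ℕ) → (∀ i → degree Γ i ≤ D) →
  (T : Subset b) → Dominated Γ T →
  Σ (AdmissibleSet Γ) λ H → HB H ⊆ T × ∣ T ∣ ≤ ∣ HB H ∣ * D
greedy {zero} {b} Γ D _ T dom =
  admissibleSet ⊥ ⊥ (λ j j∈⊥ → ⊥-elim (∉⊥ j∈⊥)) , (⊥-elim ∘ ∉⊥) , T-empty
  where
  T⊆⊥ : T ⊆ ⊥
  T⊆⊥ {j} j∈T with dom j j∈T
  ... | () , _
  T-empty : ∣ T ∣ ≤ ∣ ⊥ {b} ∣ * D
  T-empty = subst (λ k → ∣ T ∣ ≤ k * D) (sym (∣⊥∣≡0 b))
                  (≤-trans (p⊆q⇒∣p∣≤∣q∣ T⊆⊥) (≤-reflexive (∣⊥∣≡0 b)))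
greedy {suc a} Γ D deg≤D T dom
  with any? (λ t → (t ∈? T) ×-dec privateToFirst? Γ t)
... | no noPrivate
  with greedy (later Γ) D (deg≤D ∘ suc) T (dominated-skip Γ dom noPrivate)
...   | admissibleSet HA HB adm , HB⊆T , bound =
  admissibleSet (outside ∷ HA) HB (admissible-skip Γ adm) , HB⊆T , bound
greedy {suc a} Γ D deg≤D T dom
    | yes (t , t∈T , t-private)
  with greedy (later Γ) D (deg≤D ∘ suc) (T ─ neighbours Γ zero) (dominated-take Γ dom)
...   | admissibleSet HA HB adm , HB⊆T─N₀ , bound =
  admissibleSet (inside ∷ HA) (⁅ t ⁆ ∪ HB) (admissible-take Γ adm HB∩N₀≡∅ t-private) ,
  ⁅x⁆∪p⊆q t∈T (p─q⊆p T N₀ ∘ HB⊆T─N₀) ,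
  subst (λ k → ∣ T ∣ ≤ k * D) (sym (∣⁅x⁆∪p∣≡1+∣p∣ t HB t∉HB)) T-bound
  where
  N₀ : Subset _
  N₀ = neighbours Γ zero
  HB∩N₀≡∅ : ∀ {j} → j ∈ HB → j ∉ N₀
  HB∩N₀≡∅ = x∈p─q⇒x∉q T N₀ ∘ HB⊆T─N₀
  t∉HB : t ∉ HB
  t∉HB t∈HB = HB∩N₀≡∅ t∈HB (∈-neighbours⁺ Γ (proj₁ t-private))
  -- |T| ≤ |T ─ N₀| + |N₀| ≤ |HB| · D + D
  T-bound : ∣ T ∣ ≤ suc ∣ HB ∣ * D
  T-bound = ≤-trans (∣p∣≤∣p─q∣+∣q∣ T N₀)
           (≤-trans (+-mono-≤ bound (deg≤D zero)) (≤-reflexive (+-comm (∣ HB ∣ * D) D)))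

argmax : ∀ {n} (f : Fin (suc n) → ℕ) → ∃ λ i → ∀ k → f k ≤ f i
argmax {zero}  f = zero , λ { zero → ≤-refl }
argmax {suc n} f with argmax (f ∘ suc)
... | i , max with f zero ≤? f (suc i)
...   | yes f0≤ = suc i , λ { zero → f0≤ ; (suc k) → max k }
...   | no  f0≰ = zero  , λ { zero → ≤-refl ; (suc k) → ≤-trans (max k) (<⇒≤ (≰⇒> f0≰)) }

largestStar : ∀ {a b} (Γ : BipartiteGraph a b) →
  Σ (AdmissibleSet Γ) λ H → ∀ i → degree Γ i ≤ ∣ HB H ∣
largestStar {zero}  Γ = admissibleSet ⊥ ⊥ (λ j j∈⊥ → ⊥-elim (∉⊥ j∈⊥)) , λ ()
largestStar {suc a} Γ with argmax (degree Γ)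
... | i , max = star Γ i , max

bound-by-square : ∀ {n} h d → n ≤ h * d → n ≤ h * h ⊎ n ≤ d * d
bound-by-square h d n≤hd with ≤-total d h
... | inj₁ d≤h = inj₁ (≤-trans n≤hd (*-monoʳ-≤ h d≤h))
... | inj₂ h≤d = inj₂ (≤-trans n≤hd (*-monoˡ-≤ d h≤d))

lemma3p1 : (a b : ℕ) (Γ : BipartiteGraph a b) → BSideNoIsolated Γ →
    Σ (Subset a) λ HA → Σ (Subset b) λ HB →
    Admissible Γ HA HB × b ≤ ∣ HB ∣ * ∣ HB ∣
lemma3p1 a b Γ noIsolated
  with largestStar Γ
... | S , deg≤S
  with greedy Γ ∣ HB S ∣ deg≤S ⊤ (λ j _ → noIsolated j)
...   | G , _ , bound
  with bound-by-square ∣ HB G ∣ ∣ HB S ∣ (subst (_≤ ∣ HB G ∣ * ∣ HB S ∣) (∣⊤∣≡n b) bound)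
...     | inj₁ b≤G² = HA G , HB G , isAdmissible G , b≤G²
...     | inj₂ b≤S² = HA S , HB S , isAdmissible S , b≤S²
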